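{- Let $S$ be an RNA sequence of length $n$, $w$ a positive integer, and $i,j,s$ integers with $1\le i\le sw$ and $(s+1)w< j\le n$. Define the $(i,s)$ left difference vector $U\in\{0,1\}^w$ by $U(q)=M[i,sw+q]-M[i,sw+q-1]$ and the $(j,s)$ right difference vector $V\in\{0,1\}^w$ by $V(q)=M[sw+q,j]-M[sw+q+1,j]$ for $1\le q\le w$. Then there are functions $\rho,\delta$ on $\{0,1\}^w\times\{0,1\}^w$ (not depending on $S,i,j,s$) such that $r=\rho(U,V)$ is an $(i,j)$ representative of $I_s$, i.e. $1\le r\le w$ and $M[i,sw+r]+M[sw+r+1,j]=\max_{sw+1\le p\le (s+1)w}\{M[i,p]+M[p+1,j]\}$, and $\delta(U,V)$ equals the $(i,j)$ deviation $M[i,sw+r]+M[sw+r+1,j]-M[i,sw+1]-M[sw+2,j]$. In other words, both the $(i,j)$ representative and the $(i,j)$ deviation of $I_s$ are determined by the $(i,s)$ left difference vector and the $(j,s)$ right difference vector.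
   Context: An RNA sequence is a string $S[1\cdots n]$ over $\{A,C,G,U\}$. Nucleotides are complementary if they are $\{A,U\}$ or $\{G,C\}$. A base pair is a pair of positions $(p,q)$, $p<q$, with $S[p],S[q]$ complementary. A set of base pairs is non-crossing if each position occurs in at most one pair and there are no two pairs $(a,b),(c,d)$ with $a<c<b<d$. For $1\le a\le b\le n$, $M[a,b]$ is the maximum number of base pairs in a non-crossing set of base pairs all of whose positions lie in $\{a,\dots,b\}$. $I_s$ denotes the interval $\{sw+1,\dots,(s+1)w\}$. (Each $U(q),V(q)$ lies in $\{0,1\}$.) -}

module Defs where

open import Data.Nat using (ℕ; zero; suc; _+_; _*_; _≤_; _<_)
open import Data.Integer using (ℤ; +_; _-_)
open import Data.List using (List; []; _∷_; length; lookup)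
open import Data.Maybe using (Maybe; just; nothing)
open import Data.Product using (_×_; _,_; ∃; ∃-syntax; proj₁; proj₂)
open import Data.Sum using (_⊎_)
open import Data.Fin using (Fin)
open import Relation.Binary.PropositionalEquality using (_≡_; _≢_)
open import Relation.Nullary using (¬_)

data Nuc : Set where
  A C G U : Nuc

data Compl : Nuc → Nuc → Set where
  AU : Compl A U
  UA : Compl U A
  GC : Compl G C
  CG : Compl C G

RNA : Set
RNA = List Nuc

-- 1-indexed access: at S p = S[p] for 1 ≤ p ≤ length S, nothing otherwise
at : RNA → ℕ → Maybe Nuc
at []      _             = nothing
at (_ ∷ _) zero          = nothing
at (x ∷ _) (suc zero)    = just x
at (_ ∷ S) (suc (suc p)) = at S (suc p)

BasePairIn : RNA → ℕ → ℕ → ℕ × ℕ → Set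
BasePairIn S a b (p , q) =
  a ≤ p × p < q × q ≤ b ×
  ∃[ x ] ∃[ y ] (at S p ≡ just x × at S q ≡ just y × Compl x y)

DisjointPairs : ℕ × ℕ → ℕ × ℕ → Set
DisjointPairs (p , q) (p' , q') = p ≢ p' × p ≢ q' × q ≢ p' × q ≢ q'

NotCross : ℕ × ℕ → ℕ × ℕ → Set
NotCross (a , b) (c , d) = ¬ (a < c × c < b × b < d)

-- A non-crossing set of base pairs of S, all positions in {a,…,b},
-- given as a list of pairs (each position occurs in at most one pair,
-- so list entries are pairwise distinct and the length is the size).
NonCrossingIn : RNA → ℕ → ℕ → List (ℕ × ℕ) → Set
NonCrossingIn S a b P =
  (∀ (k : Fin (length P)) → BasePairIn S a b (lookup P k)) ×
  (∀ (k l : Fin (length P)) → k ≢ l →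
     DisjointPairs (lookup P k) (lookup P l) ×
     NotCross (lookup P k) (lookup P l))

-- m = M[a,b]: the maximum number of base pairs in a non-crossing set of
-- base pairs all of whose positions lie in {a,…,b}.
IsMaxPairs : RNA → ℕ → ℕ → ℕ → Set
IsMaxPairs S a b m =
  (∃[ P ] (NonCrossingIn S a b P × length P ≡ m)) ×
  (∀ P → NonCrossingIn S a b P → length P ≤ m)

IsMTable : RNA → (ℕ → ℕ → ℕ) → Set
IsMTable S M = ∀ a b → 1 ≤ a → a ≤ b → b ≤ length S → IsMaxPairs S a b (M a b)

-- difference vectors (q ranges over 1..w, encoded by Fin w as q = 1 + toℕ k)

module Submission where

-- Write
-- α(x) = M[i, sw+x] and β(x) = M[sw+x, j]; the candidate value of the split
-- point sw+r is α(r) + β(r+1), and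
--
--     α(r) + β(r+1) - (α(1) + β(2))  =  Σ_{q=2..r} (U(q) - V(q)),
--
-- since U(q) = α(q) - α(q-1) and V(q) = β(q) - β(q+1).  The right-hand side,
-- the "gain" of r, is computed from U and V alone.  Hence ρ(U,V) can be taken
-- to be a maximiser of the gain over 1 ≤ r ≤ w, and δ(U,V) its maximal gain.
--
-- These combine into the correctness of ρ and δ for arbitrary
-- profiles α, β, which is specialised to the row and column of an arbitrary
-- table M around a block {o+1,…,o+w}; lemma2 is the case o = sw.

open import Defs
open import Data.Nat using (ℕ; zero; suc; _+_; _*_; _∸_; _≤_; _<_; _<?_; s≤s; z≤n)
import Data.Nat.Properties as ℕP
open import Data.Integer using (ℤ; +_; _-_)
import Data.Integer as ℤ
import Data.Integer.Properties as ℤP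
open import Data.Integer.Tactic.RingSolver using (solve-∀)
open import Data.List using (length)
open import Data.Fin using (Fin; toℕ; fromℕ<)
open import Data.Fin.Properties using (toℕ-fromℕ<)
open import Data.Product using (_×_; Σ; _,_; ∃-syntax)
open import Data.Sum using (inj₁; inj₂)
open import Relation.Nullary using (yes; no; contradiction)
open import Relation.Binary.PropositionalEquality
  using (_≡_; refl; sym; trans; cong; cong₂; subst; subst₂; module ≡-Reasoning)

argmax : (ℕ → ℤ) → ℕ → ℕ
argmax f zero = 1
argmax f (suc m) with f (argmax f m) ℤ.≤? f (suc m)
... | yes _ = suc m
... | no  _ = argmax f m

argmax-≥1 : (f : ℕ → ℤ) (m : ℕ) → 1 ≤ argmax f m
argmax-≥1 f zero = s≤s z≤n
argmax-≥1 f (suc m) with f (argmax f m) ℤ.≤? f (suc m)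
... | yes _ = s≤s z≤n
... | no  _ = argmax-≥1 f m

argmax-≤ : (f : ℕ → ℤ) (m : ℕ) → 1 ≤ m → argmax f m ≤ m
argmax-≤ f (suc m) _ = bound m
  where
  bound : (n : ℕ) → argmax f (suc n) ≤ suc n
  bound zero with f 1 ℤ.≤? f 1
  ... | yes _ = ℕP.≤-refl
  ... | no  _ = ℕP.≤-refl
  bound (suc n) with f (argmax f (suc n)) ℤ.≤? f (suc (suc n))
  ... | yes _ = ℕP.≤-refl
  ... | no  _ = ℕP.m≤n⇒m≤1+n (bound n)

argmax-step : (f : ℕ → ℤ) (m : ℕ) → f (argmax f m) ℤ.≤ f (argmax f (suc m))
argmax-step f m with f (argmax f m) ℤ.≤? f (suc m)
... | yes le = le
... | no  _  = ℤP.≤-refl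

argmax-max : (f : ℕ → ℤ) (m r : ℕ) → 1 ≤ r → r ≤ m → f r ℤ.≤ f (argmax f m)
argmax-max f zero (suc r) (s≤s _) ()
argmax-max f (suc m) r 1≤r r≤1+m with ℕP.m≤n⇒m<n∨m≡n r≤1+m
... | inj₁ (s≤s r≤m) = ℤP.≤-trans (argmax-max f m r 1≤r r≤m) (argmax-step f m)
... | inj₂ refl with f (argmax f m) ℤ.≤? f (suc m)
...   | yes _  = ℤP.≤-refl
...   | no  gt = ℤP.<⇒≤ (ℤP.≰⇒> gt)

cancel-− : ∀ (x y c : ℕ) → + x - + c ℤ.≤ + y - + c → x ≤ y
cancel-− x y c le =
  ℤP.drop‿+≤+ (subst₂ ℤ._≤_ (minus-plus (+ x) (+ c)) (minus-plus (+ y) (+ c))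
                            (ℤP.+-monoˡ-≤ (+ c) le))
  where
  minus-plus : ∀ (z d : ℤ) → (z - d) ℤ.+ d ≡ z
  minus-plus = solve-∀

block-offset : ∀ o w p → o + 1 ≤ p → p ≤ o + w → ∃[ r ] (1 ≤ r × r ≤ w × o + r ≡ p)
block-offset o w p o+1≤p p≤o+w = p ∸ o , 1≤r , r≤w , o+r≡p
  where
  o+r≡p : o + (p ∸ o) ≡ p
  o+r≡p = ℕP.m+[n∸m]≡n (ℕP.≤-trans (ℕP.m≤m+n o 1) o+1≤p)
  1≤r : 1 ≤ p ∸ o
  1≤r = ℕP.+-cancelˡ-≤ o 1 (p ∸ o) (subst (o + 1 ≤_) (sym o+r≡p) o+1≤p)
  r≤w : p ∸ o ≤ w
  r≤w = ℕP.+-cancelˡ-≤ o (p ∸ o) w (subst (_≤ o + w) (sym o+r≡p) p≤o+w)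

module DifferenceVectors (w : ℕ) where

  entry : (Fin w → ℤ) → ℕ → ℤ
  entry v t with t <? w
  ... | yes t<w = v (fromℕ< t<w)
  ... | no  _   = ℤ.0ℤ

  entry-tabulate : (h : ℕ → ℤ) → ∀ t → t < w → entry (λ k → h (toℕ k)) t ≡ h t
  entry-tabulate h t t<w with t <? w
  ... | yes t<w′ = cong h (toℕ-fromℕ< t<w′)
  ... | no  t≮w  = contradiction t<w t≮w

  -- Left and right difference vectors of profiles α, β : ℕ → ℕ; the entry with
  -- index k stands for q = k + 1, so U(q) = α(q) - α(q-1), V(q) = β(q) - β(q+1).
  leftDiff : (ℕ → ℕ) → Fin w → ℤ
  leftDiff α k = + α (suc (toℕ k)) - + α (toℕ k)

  rightDiff : (ℕ → ℕ) → Fin w → ℤ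
  rightDiff β k = + β (suc (toℕ k)) - + β (suc (suc (toℕ k)))

  gain : (u v : Fin w → ℤ) → ℕ → ℤ
  gain u v zero = ℤ.0ℤ
  gain u v (suc zero) = ℤ.0ℤ
  gain u v (suc (suc t)) = gain u v (suc t) ℤ.+ (entry u (suc t) - entry v (suc t))

  -- One telescoping step: adding U(q) - V(q) moves the split from q-1 to q.
  telescope-step : ∀ (a₁ a₂ b₂ b₃ c : ℤ) →
    ((a₁ ℤ.+ b₂) - c) ℤ.+ ((a₂ - a₁) - (b₂ - b₃)) ≡ (a₂ ℤ.+ b₃) - c
  telescope-step = solve-∀

  gain-telescopes : (α β : ℕ → ℕ) → ∀ r → 1 ≤ r → r ≤ w →
    gain (leftDiff α) (rightDiff β) r ≡ + (α r + β (suc r)) - + (α 1 + β 2)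
  gain-telescopes α β (suc zero) _ _ = sym (ℤP.+-inverseʳ (+ (α 1 + β 2)))
  gain-telescopes α β (suc (suc t)) _ 2+t≤w = begin
      gain ΔL ΔR (suc t) ℤ.+ (entry ΔL (suc t) - entry ΔR (suc t))
    ≡⟨ cong₂ (λ x y → gain ΔL ΔR (suc t) ℤ.+ (x - y))
             (entry-tabulate (λ x → + α (suc x) - + α x) (suc t) 2+t≤w)
             (entry-tabulate (λ x → + β (suc x) - + β (suc (suc x))) (suc t) 2+t≤w) ⟩
      gain ΔL ΔR (suc t) ℤ.+ d
    ≡⟨ cong (ℤ._+ d) (gain-telescopes α β (suc t) (s≤s z≤n) (ℕP.<⇒≤ 2+t≤w)) ⟩
      (+ (α (1 + t) + β (2 + t)) - c) ℤ.+ d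
    ≡⟨ cong (λ x → (x - c) ℤ.+ d) (ℤP.pos-+ (α (1 + t)) (β (2 + t))) ⟩
      ((+ α (1 + t) ℤ.+ + β (2 + t)) - c) ℤ.+ d
    ≡⟨ telescope-step (+ α (1 + t)) (+ α (2 + t)) (+ β (2 + t)) (+ β (3 + t)) c ⟩
      (+ α (2 + t) ℤ.+ + β (3 + t)) - c
    ≡⟨ cong (_- c) (sym (ℤP.pos-+ (α (2 + t)) (β (3 + t)))) ⟩
      + (α (2 + t) + β (3 + t)) - c
    ∎
    where
    open ≡-Reasoning
    ΔL ΔR : Fin w → ℤ
    ΔL = leftDiff α
    ΔR = rightDiff β
    c d : ℤ
    c = + (α 1 + β 2)
    d = (+ α (2 + t) - + α (1 + t)) - (+ β (2 + t) - + β (3 + t))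

  representative : (u v : Fin w → ℤ) → ℕ
  representative u v = argmax (gain u v) w

  deviation : (u v : Fin w → ℤ) → ℤ
  deviation u v = gain u v (representative u v)

  representative-correct : 1 ≤ w → (α β : ℕ → ℕ) →
    let r = representative (leftDiff α) (rightDiff β) in
    1 ≤ r × r ≤ w ×
    (∀ q → 1 ≤ q → q ≤ w → α q + β (suc q) ≤ α r + β (suc r)) ×
    deviation (leftDiff α) (rightDiff β) ≡ + (α r + β (suc r)) - + (α 1 + β 2)
  representative-correct 1≤w α β = 1≤r , r≤w , maximal , gain-telescopes α β r 1≤r r≤w
    where
    f : ℕ → ℤ
    f = gain (leftDiff α) (rightDiff β)
    r : ℕ
    r = argmax f w
    1≤r : 1 ≤ r
    1≤r = argmax-≥1 f w
    r≤w : r ≤ w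
    r≤w = argmax-≤ f w 1≤w
    maximal : ∀ q → 1 ≤ q → q ≤ w → α q + β (suc q) ≤ α r + β (suc r)
    maximal q 1≤q q≤w =
      cancel-− _ _ (α 1 + β 2)
        (subst₂ ℤ._≤_ (gain-telescopes α β q 1≤q q≤w) (gain-telescopes α β r 1≤r r≤w)
                      (argmax-max f w q 1≤q q≤w))

  block-representative : 1 ≤ w → (M : ℕ → ℕ → ℕ) (i j o : ℕ) →
    let ΔL : Fin w → ℤ
        ΔL = leftDiff (λ x → M i (o + x))
        ΔR : Fin w → ℤ
        ΔR = rightDiff (λ x → M (o + x) j)
        r : ℕ
        r = representative ΔL ΔR
    in (1 ≤ r × r ≤ w ×
        (∀ p → o + 1 ≤ p → p ≤ o + w → M i p + M (suc p) j ≤ M i (o + r) + M (o + r + 1) j)) ×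
       deviation ΔL ΔR ≡ + (M i (o + r) + M (o + r + 1) j) - + (M i (o + 1) + M (o + 2) j)
  block-representative 1≤w M i j o
    with representative-correct 1≤w (λ x → M i (o + x)) (λ x → M (o + x) j)
  ... | 1≤r , r≤w , best-split , deviation-eq =
    (1≤r , r≤w , maximal) ,
    subst (λ x → deviation ΔL ΔR ≡ + (M i (o + r) + M x j) - + (M i (o + 1) + M (o + 2) j))
          (sym (shift r)) deviation-eq
    where
    ΔL ΔR : Fin w → ℤ
    ΔL = leftDiff (λ x → M i (o + x))
    ΔR = rightDiff (λ x → M (o + x) j)
    r : ℕ
    r = representative ΔL ΔR
    shift : ∀ q → o + q + 1 ≡ o + suc q
    shift q = trans (ℕP.+-comm (o + q) 1) (sym (ℕP.+-suc o q))
    maximal : ∀ p → o + 1 ≤ p → p ≤ o + w → M i p + M (suc p) j ≤ M i (o + r) + M (o + r + 1) j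
    maximal p lo hi with block-offset o w p lo hi
    ... | q , 1≤q , q≤w , refl =
      subst₂ (λ x y → M i (o + q) + M x j ≤ M i (o + r) + M y j)
             (ℕP.+-suc o q) (sym (shift r)) (best-split q 1≤q q≤w)

lemma2 : ∀ (w : ℕ) → 1 ≤ w →
    Σ ((Fin w → ℤ) → (Fin w → ℤ) → ℕ) λ ρ → Σ ((Fin w → ℤ) → (Fin w → ℤ) → ℤ) λ δ → (∀ (S : RNA) (i j s : ℕ) (M : ℕ → ℕ → ℕ) →
      IsMTable S M →
      1 ≤ i → i ≤ s * w → (suc s) * w < j → j ≤ length S →
      let U : Fin w → ℤ
          U k = + M i (s * w + suc (toℕ k)) - + M i (s * w + toℕ k)
          V : Fin w → ℤ
          V k = + M (s * w + suc (toℕ k)) j - + M (s * w + suc (suc (toℕ k))) j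
          r : ℕ
          r = ρ U V
      in (1 ≤ r × r ≤ w ×
          (∀ p → s * w + 1 ≤ p → p ≤ (suc s) * w →
             M i p + M (suc p) j ≤ M i (s * w + r) + M (s * w + r + 1) j)) ×
         δ U V ≡ (+ (M i (s * w + r) + M (s * w + r + 1) j))
                   - (+ (M i (s * w + 1) + M (s * w + 2) j)))
lemma2 w 1≤w = representative , deviation , λ S i j s M _ _ _ _ _ →
  let ((1≤r , r≤w , maximal) , deviation-eq) = block-representative 1≤w M i j (s * w)
      in-block : ∀ p → p ≤ suc s * w → p ≤ s * w + w
      in-block p p≤ = subst (p ≤_) (ℕP.+-comm w (s * w)) p≤
  in (1≤r , r≤w , λ p lo hi → maximal p lo (in-block p hi)) , deviation-eq
  where open DifferenceVectors w
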